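{- Let $f \in \mathbf{Z}[X]$ be primitive, and let $p_1, \ldots, p_m$ ($m \geq 1$) be distinct prime numbers, none of which divides the leading coefficient $\operatorname{lc}(f)$ of $f$. Let $$d = \min\Big( \bigcap_{i=1}^{m} S(D_{p_i}) \setminus \{0\} \Big)$$ (with the convention $\min \emptyset = +\infty$). If $a \in \mathbf{Z}[X]$ divides $f$ in $\mathbf{Z}[X]$ and $a$ is neither $1$ nor $-1$, then $d \leq \deg a$.
   Context: A polynomial in $\mathbf{Z}[X]$ is primitive if the gcd of its coefficients is $1$. For a prime $p$ not dividing $\operatorname{lc}(f)$, let $\bar f \in \mathbf{F}_p[X]$ be the reduction of $f$ modulo $p$ and write $\bar f = \prod_{i=1}^{k} g_i$ with each $g_i$ irreducible in $\mathbf{F}_p[X]$ (units absorbed into a factor). Let $D_p = (\deg g_i)_{i=1}^k$ be the tuple (multiset, with multiplicity) of degrees of these irreducible factors, and let $S(D_p)$ be the set of all subset sums of $D_p$ (including the empty sum $0$). -}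

module Defs where

open import Data.Nat as ℕ using (ℕ; zero; suc; _∸_; _≤_)
open import Data.Nat.GCD using (gcd)
open import Data.Nat.Divisibility using (_∣_; _∣?_)
open import Data.Integer as ℤ using (ℤ; +_; -[1+_]; ∣_∣)
open import Data.List using (List; []; _∷_; foldr; length; map)
open import Data.Product using (Σ; _×_)
open import Relation.Nullary using (¬_; yes; no)
open import Relation.Binary.PropositionalEquality using (_≡_; _≢_)

-- Polynomials in ℤ[X] are coefficient lists, lowest degree first;
-- trailing zeros are allowed and ignored.
Poly : Set
Poly = List ℤ

coeff : Poly → ℕ → ℤ
coeff []       _       = + 0
coeff (c ∷ _)  zero    = c
coeff (_ ∷ cs) (suc n) = coeff cs n

_≈ₚ_ : Poly → Poly → Set
a ≈ₚ b = ∀ n → coeff a n ≡ coeff b n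

EqMod : ℕ → Poly → Poly → Set
EqMod p a b = ∀ n → p ∣ ∣ coeff a n ℤ.- coeff b n ∣

addP : Poly → Poly → Poly
addP []       q        = q
addP (x ∷ xs) []       = x ∷ xs
addP (x ∷ xs) (y ∷ ys) = (x ℤ.+ y) ∷ addP xs ys

mulP : Poly → Poly → Poly
mulP []       q = []
mulP (a ∷ as) q = addP (map (a ℤ.*_) q) (+ 0 ∷ mulP as q)

prodP : List Poly → Poly
prodP = foldr mulP (+ 1 ∷ [])

_∣ₚ_ : Poly → Poly → Set
a ∣ₚ f = Σ Poly (λ b → mulP a b ≈ₚ f)

strip : Poly → Poly
strip []       = []
strip (x ∷ xs) with strip xs
... | y ∷ ys = x ∷ y ∷ ys
... | []     with ∣ x ∣ ℕ.≟ 0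
...   | yes _ = []
...   | no  _ = x ∷ []

stripMod : ℕ → Poly → Poly
stripMod p []       = []
stripMod p (x ∷ xs) with stripMod p xs
... | y ∷ ys = x ∷ y ∷ ys
... | []     with p ∣? ∣ x ∣
...   | yes _ = []
...   | no  _ = x ∷ []

-- degree in ℤ[X] (degree of 0 is 0 by convention; irrelevant here)
deg : Poly → ℕ
deg a = length (strip a) ∸ 1

degMod : ℕ → Poly → ℕ
degMod p a = length (stripMod p a) ∸ 1

-- leading coefficient (0 for the zero polynomial)
lastOr : ℤ → Poly → ℤ
lastOr d []       = d
lastOr d (x ∷ xs) = lastOr x xs

lc : Poly → ℤ
lc a = lastOr (+ 0) (strip a)

content : Poly → ℕ
content = foldr (λ c g → gcd ∣ c ∣ g) 0

Primitive : Poly → Set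
Primitive f = content f ≡ 1

-- irreducibility in 𝔽_p[X] of the reduction of g: g is nonzero and not a
-- unit (degree ≥ 1 mod p), and any factorization g ≡ u v (mod p) has a
-- unit factor (nonzero constant mod p, i.e. degree 0 mod p; u, v are
-- automatically nonzero mod p as g is).
IrredMod : ℕ → Poly → Set
IrredMod p g = (1 ≤ degMod p g)
             × (∀ u v → EqMod p g (mulP u v) → degMod p u ≡ 0 Data.Sum.⊎ degMod p v ≡ 0)
  where import Data.Sum

data SubsetSum : List ℕ → ℕ → Set where
  ss-nil  : SubsetSum [] 0
  ss-skip : ∀ {d ds n} → SubsetSum ds n → SubsetSum (d ∷ ds) n
  ss-take : ∀ {d ds n} → SubsetSum ds n → SubsetSum (d ∷ ds) (d ℕ.+ n)

{-# OPTIONS --safe #-}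

-- Reduce a factorisation a · b = f modulo each p = pᵢ. As p ∤ lc f, reduction preserves the degree
-- of a: degrees can only drop, while degₚ a + degₚ b = degₚ f = deg f = deg a + deg b. Over 𝔽ₚ,
-- division with remainder yields Bézout identities and hence Euclid's lemma for irreducibles, so
-- from a · b ≡ ∏ gⱼ the factor a is, up to a unit, a subproduct of the gⱼ and deg a ∈ S(D_p).
-- Primitivity of f makes every constant factor ±1, so deg a ≠ 0: it is a nonzero common subset
-- sum, and the least one is at most deg a.

module Submission where

open import Defs
open import Algebra.Bundles using (CommutativeRing)
open import Algebra.Structures using (IsCommutativeRing)
open import Algebra.Solver.Ring.AlmostCommutativeRing using (fromCommutativeRing; _-Raw-AlmostCommutative⟶_)
open import Data.Empty using (⊥-elim)
open import Data.Fin using (Fin)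
import Data.Fin.Properties as FinP
open import Data.Integer as ℤ using (ℤ; +_; -[1+_]; ∣_∣; _+_; _*_; -_; _-_)
import Data.Integer.Properties as ℤP
open import Data.Integer.Divisibility.Signed as ℤ∣ using (∣ᵤ⇒∣; ∣⇒∣ᵤ)
open import Data.Integer.Tactic.RingSolver using (solve-∀)
open import Data.List using (List; []; _∷_; map; length)
open import Data.List.Relation.Unary.All using (All; []; _∷_)
open import Data.Maybe using (Maybe; just; nothing)
open import Data.Nat as ℕ using (ℕ; zero; suc; _≤_; _<_; z≤n; s≤s; _∸_; _≤?_)
open import Data.Nat.Coprimality using (Coprime; coprime-Bézout)
open import Data.Nat.Divisibility as ℕ∣ using (_∣_; _∣?_; _∣0)
open import Data.Nat.GCD using (gcd-greatest; module Bézout)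
open import Data.Nat.Induction using (<-rec)
open import Data.Nat.Primality using (Prime; euclidsLemma; ¬prime[1]; prime⇒irreducible)
import Data.Nat.Properties as ℕP
open import Data.Product using (Σ; ∃; ∃₂; _×_; _,_; proj₁; proj₂)
open import Data.Sum as Sum using (_⊎_; inj₁; inj₂; [_,_]′)
open import Function using (_∘_)
open import Function.Definitions using (Injective)
open import Relation.Binary.Bundles using (Setoid)
open import Relation.Binary.PropositionalEquality
open import Relation.Nullary using (¬_; Dec; yes; no)
open import Relation.Nullary.Decidable using (map′; ¬?; _×-dec_)

module Congruence (q : ℕ) where

  infix 4 _≋_
  record _≋_ (x y : ℤ) : Set where
    constructor mk≋
    field ∣difference : q ∣ ∣ x - y ∣
  open _≋_ public

  private
    ≋-via : ∀ {x y L} → x - y ≡ L → + q ℤ∣.∣ L → x ≋ y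
    ≋-via e d = mk≋ (∣⇒∣ᵤ (subst (+ q ℤ∣.∣_) (sym e) d))

    ∣≋ : ∀ {x y} → x ≋ y → + q ℤ∣.∣ (x - y)
    ∣≋ d = ∣ᵤ⇒∣ (∣difference d)

  ≋-refl : ∀ {x} → x ≋ x
  ≋-refl {x} = ≋-via (ℤP.+-inverseʳ x) (∣ᵤ⇒∣ {+ q} {+ 0} (q ∣0))

  ≋-reflexive : ∀ {x y} → x ≡ y → x ≋ y
  ≋-reflexive refl = ≋-refl

  ≋-sym : ∀ {x y} → x ≋ y → y ≋ x
  ≋-sym {x} {y} d = ≋-via (identity x y) (ℤ∣.∣m⇒∣-m (∣≋ d))
    where
    identity : ∀ x y → y - x ≡ - (x - y)
    identity = solve-∀

  ≋-trans : ∀ {x y z} → x ≋ y → y ≋ z → x ≋ z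
  ≋-trans {x} {y} {z} d e = ≋-via (identity x y z) (ℤ∣.∣m∣n⇒∣m+n (∣≋ d) (∣≋ e))
    where
    identity : ∀ x y z → x - z ≡ (x - y) + (y - z)
    identity = solve-∀

  +-≋ : ∀ {x y u v} → x ≋ y → u ≋ v → x + u ≋ y + v
  +-≋ {x} {y} {u} {v} d e = ≋-via (identity x y u v) (ℤ∣.∣m∣n⇒∣m+n (∣≋ d) (∣≋ e))
    where
    identity : ∀ x y u v → (x + u) - (y + v) ≡ (x - y) + (u - v)
    identity = solve-∀

  *-≋ : ∀ {x y u v} → x ≋ y → u ≋ v → x * u ≋ y * v
  *-≋ {x} {y} {u} {v} d e =
    ≋-via (identity x y u v)
      (ℤ∣.∣m∣n⇒∣m+n (ℤ∣.∣m⇒∣m*n u (∣≋ d)) (ℤ∣.∣n⇒∣m*n y (∣≋ e)))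
    where
    identity : ∀ x y u v → (x * u) - (y * v) ≡ (x - y) * u + y * (u - v)
    identity = solve-∀

  -‿≋ : ∀ {x y} → x ≋ y → - x ≋ - y
  -‿≋ {x} {y} d = ≋-via (identity x y) (ℤ∣.∣m⇒∣-m (∣≋ d))
    where
    identity : ∀ x y → (- x) - (- y) ≡ - (x - y)
    identity = solve-∀

  IsZero : ℤ → Set
  IsZero x = x ≋ + 0

  isZero? : ∀ x → Dec (IsZero x)
  isZero? x = map′ mk≋ ∣difference (q ∣? ∣ x - + 0 ∣)

  ∣⇒IsZero : ∀ {x} → q ∣ ∣ x ∣ → IsZero x
  ∣⇒IsZero {x} d = mk≋ (subst (λ t → q ∣ ∣ t ∣) (sym (ℤP.+-identityʳ x)) d)

  IsZero⇒∣ : ∀ {x} → IsZero x → q ∣ ∣ x ∣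
  IsZero⇒∣ {x} z = subst (λ t → q ∣ ∣ t ∣) (ℤP.+-identityʳ x) (∣difference z)

  +-IsZeroʳ : ∀ x {y} → IsZero y → x + y ≋ x
  +-IsZeroʳ x {y} z = subst (x + y ≋_) (ℤP.+-identityʳ x) (+-≋ (≋-refl {x}) z)

  +-IsZeroˡ : ∀ {x} y → IsZero x → x + y ≋ y
  +-IsZeroˡ {x} y z = subst (x + y ≋_) (ℤP.+-identityˡ y) (+-≋ z (≋-refl {y}))

  *-IsZeroʳ : ∀ x {y} → IsZero y → IsZero (x * y)
  *-IsZeroʳ x {y} z = subst (x * y ≋_) (ℤP.*-zeroʳ x) (*-≋ (≋-refl {x}) z)

  *-inverse-cancelʳ : ∀ c {u v} → u * v ≋ + 1 → c * u * v ≋ c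
  *-inverse-cancelʳ c {u} {v} uv≋1 =
    subst₂ _≋_ (sym (ℤP.*-assoc c u v)) (ℤP.*-identityʳ c) (*-≋ (≋-refl {c}) uv≋1)

negP : Poly → Poly
negP = map (λ x → - x)

scaleP : ℤ → Poly → Poly
scaleP c = map (c *_)

oneP : Poly
oneP = + 1 ∷ []

subP : Poly → Poly → Poly
subP a b = addP a (negP b)

coeff-addP : ∀ a b n → coeff (addP a b) n ≡ coeff a n + coeff b n
coeff-addP []       b        n       = sym (ℤP.+-identityˡ _)
coeff-addP (x ∷ xs) []       n       = sym (ℤP.+-identityʳ _)
coeff-addP (x ∷ xs) (y ∷ ys) zero    = refl
coeff-addP (x ∷ xs) (y ∷ ys) (suc n) = coeff-addP xs ys n

coeff-negP : ∀ a n → coeff (negP a) n ≡ - coeff a n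
coeff-negP []      n       = refl
coeff-negP (x ∷ a) zero    = refl
coeff-negP (x ∷ a) (suc n) = coeff-negP a n

coeff-scaleP : ∀ c a n → coeff (scaleP c a) n ≡ c * coeff a n
coeff-scaleP c []      n       = sym (ℤP.*-zeroʳ c)
coeff-scaleP c (x ∷ a) zero    = refl
coeff-scaleP c (x ∷ a) (suc n) = coeff-scaleP c a n

coeff-scaleP-addP : ∀ x b t n → coeff (addP (scaleP x b) t) n ≡ x * coeff b n + coeff t n
coeff-scaleP-addP x b t n = trans (coeff-addP (scaleP x b) t n) (cong (_+ coeff t n) (coeff-scaleP x b n))

coeff-mulP-∷ : ∀ x as b n → coeff (mulP (x ∷ as) b) n ≡ x * coeff b n + coeff (+ 0 ∷ mulP as b) n
coeff-mulP-∷ x as b = coeff-scaleP-addP x b (+ 0 ∷ mulP as b)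

coeff-subP : ∀ a b n → coeff (subP a b) n ≡ coeff a n - coeff b n
coeff-subP a b n = trans (coeff-addP a (negP b) n) (cong (_+_ (coeff a n)) (coeff-negP b n))

coeff-0∷-scaleP : ∀ x a n → coeff (+ 0 ∷ scaleP x a) n ≡ x * coeff (+ 0 ∷ a) n
coeff-0∷-scaleP x a zero    = sym (ℤP.*-zeroʳ x)
coeff-0∷-scaleP x a (suc n) = coeff-scaleP x a n

coeff-0∷-addP : ∀ a b n → coeff (+ 0 ∷ addP a b) n ≡ coeff (+ 0 ∷ a) n + coeff (+ 0 ∷ b) n
coeff-0∷-addP a b zero    = refl
coeff-0∷-addP a b (suc n) = coeff-addP a b n

monomial : ℕ → ℤ → Poly
monomial zero    c = c ∷ []
monomial (suc k) c = + 0 ∷ monomial k c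

module PolyCongruence (q : ℕ) where
  open Congruence q public

  infix 4 _≈_
  record _≈_ (a b : Poly) : Set where
    constructor mk≈
    field coeff-≋ : ∀ n → coeff a n ≋ coeff b n
  open _≈_ public

  ≈-refl : ∀ {a} → a ≈ a
  ≈-refl = mk≈ λ _ → ≋-refl

  ≈-sym : ∀ {a b} → a ≈ b → b ≈ a
  ≈-sym h = mk≈ λ n → ≋-sym (coeff-≋ h n)

  ≈-trans : ∀ {a b c} → a ≈ b → b ≈ c → a ≈ c
  ≈-trans h k = mk≈ λ n → ≋-trans (coeff-≋ h n) (coeff-≋ k n)

  ≈ₚ⇒≈ : ∀ {a b} → a ≈ₚ b → a ≈ b
  ≈ₚ⇒≈ h = mk≈ λ n → ≋-reflexive (h n)

  EqMod⇒≈ : ∀ {a b} → EqMod q a b → a ≈ b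
  EqMod⇒≈ h = mk≈ λ n → mk≋ (h n)

  ≈⇒EqMod : ∀ {a b} → a ≈ b → EqMod q a b
  ≈⇒EqMod h n = ∣difference (coeff-≋ h n)

  IsZeroPoly : Poly → Set
  IsZeroPoly a = a ≈ []

  ∷-cong : ∀ {x y a b} → x ≋ y → a ≈ b → x ∷ a ≈ y ∷ b
  ∷-cong e h = mk≈ λ { zero → e ; (suc n) → coeff-≋ h n }

  ∷-zero : ∀ {x a} → IsZero x → IsZeroPoly a → IsZeroPoly (x ∷ a)
  ∷-zero {x} z h = mk≈ λ { zero → z ; (suc n) → coeff-≋ h n }

  addP-cong : ∀ {a a′ b b′} → a ≈ a′ → b ≈ b′ → addP a b ≈ addP a′ b′
  addP-cong {a} {a′} {b} {b′} h k = mk≈ λ n →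
    subst₂ _≋_ (sym (coeff-addP a b n)) (sym (coeff-addP a′ b′ n)) (+-≋ (coeff-≋ h n) (coeff-≋ k n))

  negP-cong : ∀ {a a′} → a ≈ a′ → negP a ≈ negP a′
  negP-cong {a} {a′} h = mk≈ λ n →
    subst₂ _≋_ (sym (coeff-negP a n)) (sym (coeff-negP a′ n)) (-‿≋ (coeff-≋ h n))

  scaleP-cong : ∀ {c c′ a a′} → c ≋ c′ → a ≈ a′ → scaleP c a ≈ scaleP c′ a′
  scaleP-cong {c} {c′} {a} {a′} e h = mk≈ λ n →
    subst₂ _≋_ (sym (coeff-scaleP c a n)) (sym (coeff-scaleP c′ a′ n)) (*-≋ e (coeff-≋ h n))

  scaleP-zeroˡ : ∀ {x} b → IsZero x → IsZeroPoly (scaleP x b)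
  scaleP-zeroˡ {x} b z = mk≈ λ n →
    subst₂ _≋_ (sym (coeff-scaleP x b n)) (ℤP.*-zeroˡ (coeff b n)) (*-≋ z ≋-refl)

  addP-assoc : ∀ a b c → addP (addP a b) c ≈ addP a (addP b c)
  addP-assoc a b c = ≈ₚ⇒≈ at
    where
    at : ∀ n → coeff (addP (addP a b) c) n ≡ coeff (addP a (addP b c)) n
    at n rewrite coeff-addP (addP a b) c n | coeff-addP a b n
               | coeff-addP a (addP b c) n | coeff-addP b c n
               = ℤP.+-assoc (coeff a n) (coeff b n) (coeff c n)

  addP-comm : ∀ a b → addP a b ≈ addP b a
  addP-comm a b = ≈ₚ⇒≈ at
    where
    at : ∀ n → coeff (addP a b) n ≡ coeff (addP b a) n
    at n rewrite coeff-addP a b n | coeff-addP b a n = ℤP.+-comm (coeff a n) (coeff b n)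

  addP-identityʳ : ∀ a → addP a [] ≈ a
  addP-identityʳ a = ≈ₚ⇒≈ λ n → trans (coeff-addP a [] n) (ℤP.+-identityʳ (coeff a n))

  addP-inverseˡ : ∀ a → addP (negP a) a ≈ []
  addP-inverseˡ a = ≈ₚ⇒≈ at
    where
    at : ∀ n → coeff (addP (negP a) a) n ≡ + 0
    at n rewrite coeff-addP (negP a) a n | coeff-negP a n = ℤP.+-inverseˡ (coeff a n)

  addP-inverseʳ : ∀ a → addP a (negP a) ≈ []
  addP-inverseʳ a = ≈-trans (addP-comm a (negP a)) (addP-inverseˡ a)

  mulP-zeroˡ : ∀ {a} b → IsZeroPoly a → IsZeroPoly (mulP a b)
  mulP-zeroˡ {[]}     b h = ≈-refl
  mulP-zeroˡ {x ∷ as} b h =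
    addP-cong (scaleP-zeroˡ b (coeff-≋ h 0)) (∷-zero ≋-refl (mulP-zeroˡ {as} b (mk≈ λ n → coeff-≋ h (suc n))))

  mulP-congˡ : ∀ {a a′} b → a ≈ a′ → mulP a b ≈ mulP a′ b
  mulP-congˡ {[]}     {[]}     b h = ≈-refl
  mulP-congˡ {[]}     {y ∷ ys} b h = ≈-sym (mulP-zeroˡ b (≈-sym h))
  mulP-congˡ {x ∷ xs} {[]}     b h = mulP-zeroˡ b h
  mulP-congˡ {x ∷ xs} {y ∷ ys} b h =
    addP-cong (scaleP-cong (coeff-≋ h 0) ≈-refl)
              (∷-cong ≋-refl (mulP-congˡ {xs} {ys} b (mk≈ λ n → coeff-≋ h (suc n))))

  mulP-congʳ : ∀ a {b b′} → b ≈ b′ → mulP a b ≈ mulP a b′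
  mulP-congʳ []       h = ≈-refl
  mulP-congʳ (x ∷ as) h = addP-cong (scaleP-cong (≋-refl {x}) h) (∷-cong ≋-refl (mulP-congʳ as h))

  mulP-distribʳ : ∀ a c b → mulP (addP a c) b ≈ addP (mulP a b) (mulP c b)
  mulP-distribʳ []       c        b = ≈-refl
  mulP-distribʳ (x ∷ xs) []       b = ≈-sym (addP-identityʳ _)
  mulP-distribʳ (x ∷ xs) (y ∷ ys) b =
    ≈-trans (addP-cong ≈-refl (∷-cong ≋-refl (mulP-distribʳ xs ys b))) (≈ₚ⇒≈ at)
    where
    open ≡-Reasoning
    identity : ∀ x y B S T → (x + y) * B + (S + T) ≡ (x * B + S) + (y * B + T)
    identity = solve-∀
    at : ∀ n → coeff (addP (scaleP (x + y) b) (+ 0 ∷ addP (mulP xs b) (mulP ys b))) n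
             ≡ coeff (addP (mulP (x ∷ xs) b) (mulP (y ∷ ys) b)) n
    at n = begin
      coeff (addP (scaleP (x + y) b) (+ 0 ∷ addP (mulP xs b) (mulP ys b))) n
        ≡⟨ coeff-scaleP-addP (x + y) b _ n ⟩
      (x + y) * coeff b n + coeff (+ 0 ∷ addP (mulP xs b) (mulP ys b)) n
        ≡⟨ cong (λ t → (x + y) * coeff b n + t) (coeff-0∷-addP (mulP xs b) (mulP ys b) n) ⟩
      (x + y) * coeff b n + (coeff (+ 0 ∷ mulP xs b) n + coeff (+ 0 ∷ mulP ys b) n)
        ≡⟨ identity x y _ _ _ ⟩
      (x * coeff b n + coeff (+ 0 ∷ mulP xs b) n) + (y * coeff b n + coeff (+ 0 ∷ mulP ys b) n)
        ≡⟨ sym (cong₂ _+_ (coeff-mulP-∷ x xs b n) (coeff-mulP-∷ y ys b n)) ⟩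
      coeff (mulP (x ∷ xs) b) n + coeff (mulP (y ∷ ys) b) n
        ≡⟨ sym (coeff-addP (mulP (x ∷ xs) b) (mulP (y ∷ ys) b) n) ⟩
      coeff (addP (mulP (x ∷ xs) b) (mulP (y ∷ ys) b)) n ∎

  scaleP-mulP : ∀ x b c → mulP (scaleP x b) c ≈ scaleP x (mulP b c)
  scaleP-mulP x []       c = ≈-refl
  scaleP-mulP x (y ∷ bs) c =
    ≈-trans (addP-cong ≈-refl (∷-cong ≋-refl (scaleP-mulP x bs c))) (≈ₚ⇒≈ at)
    where
    open ≡-Reasoning
    identity : ∀ x y C S → (x * y) * C + x * S ≡ x * (y * C + S)
    identity = solve-∀
    at : ∀ n → coeff (addP (scaleP (x * y) c) (+ 0 ∷ scaleP x (mulP bs c))) n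
             ≡ coeff (scaleP x (mulP (y ∷ bs) c)) n
    at n = begin
      coeff (addP (scaleP (x * y) c) (+ 0 ∷ scaleP x (mulP bs c))) n
        ≡⟨ coeff-scaleP-addP (x * y) c _ n ⟩
      (x * y) * coeff c n + coeff (+ 0 ∷ scaleP x (mulP bs c)) n
        ≡⟨ cong (λ t → (x * y) * coeff c n + t) (coeff-0∷-scaleP x (mulP bs c) n) ⟩
      (x * y) * coeff c n + x * coeff (+ 0 ∷ mulP bs c) n
        ≡⟨ identity x y _ _ ⟩
      x * (y * coeff c n + coeff (+ 0 ∷ mulP bs c) n)
        ≡⟨ cong (x *_) (sym (coeff-mulP-∷ y bs c n)) ⟩
      x * coeff (mulP (y ∷ bs) c) n
        ≡⟨ sym (coeff-scaleP x (mulP (y ∷ bs) c) n) ⟩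
      coeff (scaleP x (mulP (y ∷ bs) c)) n ∎

  mulP-0∷ : ∀ b c → mulP (+ 0 ∷ b) c ≈ + 0 ∷ mulP b c
  mulP-0∷ b c = addP-cong (scaleP-zeroˡ c ≋-refl) ≈-refl

  mulP-assoc : ∀ a b c → mulP (mulP a b) c ≈ mulP a (mulP b c)
  mulP-assoc []       b c = ≈-refl
  mulP-assoc (x ∷ as) b c = ≈-trans (mulP-distribʳ (scaleP x b) (+ 0 ∷ mulP as b) c)
    (addP-cong (scaleP-mulP x b c) (≈-trans (mulP-0∷ (mulP as b) c) (∷-cong ≋-refl (mulP-assoc as b c))))

  mulP-[] : ∀ b → IsZeroPoly (mulP b [])
  mulP-[] []      = ≈-refl
  mulP-[] (x ∷ b) = ∷-zero ≋-refl (mulP-[] b)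

  mulP-zeroʳ : ∀ a {b} → IsZeroPoly b → IsZeroPoly (mulP a b)
  mulP-zeroʳ a z = ≈-trans (mulP-congʳ a z) (mulP-[] a)

  mulP-∷ʳ : ∀ b x as → mulP b (x ∷ as) ≈ addP (scaleP x b) (+ 0 ∷ mulP b as)
  mulP-∷ʳ []       x as = ≈-sym (∷-zero ≋-refl ≈-refl)
  mulP-∷ʳ (y ∷ bs) x as =
    ≈-trans (addP-cong (≈-refl {scaleP y (x ∷ as)}) (∷-cong ≋-refl (mulP-∷ʳ bs x as)))
            (∷-cong head (≈ₚ⇒≈ tail))
    where
    identity : ∀ A B S → A + (B + S) ≡ B + (A + S)
    identity = solve-∀
    head : y * x + + 0 ≋ x * y + + 0
    head = ≋-reflexive (cong (_+ + 0) (ℤP.*-comm y x))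
    expand : ∀ y as′ x bs′ n → coeff (addP (scaleP y as′) (addP (scaleP x bs′) (+ 0 ∷ mulP bs as))) n
                             ≡ y * coeff as′ n + (x * coeff bs′ n + coeff (+ 0 ∷ mulP bs as) n)
    expand y as′ x bs′ n =
      trans (coeff-scaleP-addP y as′ _ n) (cong (_+_ (y * coeff as′ n)) (coeff-scaleP-addP x bs′ _ n))
    tail : ∀ n → coeff (addP (scaleP y as) (addP (scaleP x bs) (+ 0 ∷ mulP bs as))) n
               ≡ coeff (addP (scaleP x bs) (addP (scaleP y as) (+ 0 ∷ mulP bs as))) n
    tail n = trans (expand y as x bs n)
                   (trans (identity (y * coeff as n) (x * coeff bs n) _) (sym (expand x bs y as n)))

  mulP-comm : ∀ a b → mulP a b ≈ mulP b a
  mulP-comm []       b = ≈-sym (mulP-[] b)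
  mulP-comm (x ∷ as) b = ≈-trans (addP-cong ≈-refl (∷-cong ≋-refl (mulP-comm as b))) (≈-sym (mulP-∷ʳ b x as))

  mulP-identityˡ : ∀ b → mulP oneP b ≈ b
  mulP-identityˡ b = ≈-trans
    (addP-cong (≈ₚ⇒≈ λ n → trans (coeff-scaleP (+ 1) b n) (ℤP.*-identityˡ (coeff b n))) (∷-zero ≋-refl ≈-refl))
    (addP-identityʳ b)

  isCommutativeRing : IsCommutativeRing _≈_ addP mulP negP [] oneP
  isCommutativeRing = record
    { isRing = record
      { +-isAbelianGroup = record
        { isGroup = record
          { isMonoid = record
            { isSemigroup = record
              { isMagma = record
                { isEquivalence = record { refl = ≈-refl ; sym = ≈-sym ; trans = ≈-trans }
                ; ∙-cong = addP-cong }
              ; assoc = addP-assoc }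
            ; identity = (λ _ → ≈-refl) , addP-identityʳ }
          ; inverse = addP-inverseˡ , addP-inverseʳ
          ; ⁻¹-cong = negP-cong }
        ; comm = addP-comm }
      ; *-cong = λ {a} {a′} h k → ≈-trans (mulP-congˡ _ h) (mulP-congʳ a′ k)
      ; *-assoc = mulP-assoc
      ; *-identity = mulP-identityˡ , λ b → ≈-trans (mulP-comm b oneP) (mulP-identityˡ b)
      ; distrib = (λ a b c → ≈-trans (mulP-comm a (addP b c))
                               (≈-trans (mulP-distribʳ b c a) (addP-cong (mulP-comm b a) (mulP-comm c a))))
                , (λ a b c → mulP-distribʳ b c a) }
    ; *-comm = mulP-comm }

  commutativeRing : CommutativeRing _ _
  commutativeRing = record { isCommutativeRing = isCommutativeRing }

  ≈-setoid : Setoid _ _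
  ≈-setoid = CommutativeRing.setoid commutativeRing

  -- The ring solver is run with integer coefficients (embedded as constant polynomials), so
  -- that coefficient cancellations such as x - x = 0 are decided in ℤ.
  private
    constant-homomorphism : ℤ.+-*-rawRing -Raw-AlmostCommutative⟶ fromCommutativeRing commutativeRing
    constant-homomorphism = record
      { ⟦_⟧    = λ c → c ∷ []
      ; +-homo = λ _ _ → ≈-refl
      ; *-homo = λ a b → ∷-cong (≋-reflexive (sym (ℤP.+-identityʳ (a * b)))) ≈-refl
      ; -‿homo = λ _ → ≈-refl
      ; 0-homo = ∷-zero ≋-refl ≈-refl
      ; 1-homo = ≈-refl }

    constant-≟ : ∀ a b → Maybe (a ∷ [] ≈ b ∷ [])
    constant-≟ a b with a ℤ.≟ b
    ... | yes refl = just ≈-refl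
    ... | no  _    = nothing

  open import Algebra.Solver.Ring ℤ.+-*-rawRing (fromCommutativeRing commutativeRing)
    constant-homomorphism constant-≟ public using (solve; _:=_; _:+_; _:*_; _:-_)

module Degree (q : ℕ) where
  open PolyCongruence q public

  record DegreeBelow (a : Poly) (N : ℕ) : Set where
    constructor mk<
    field vanishes : ∀ n → N ≤ n → IsZero (coeff a n)
  open DegreeBelow public

  HasDegree : Poly → ℕ → Set
  HasDegree a d = DegreeBelow a (suc d) × ¬ IsZero (coeff a d)

  DegreeBelow-length : ∀ a → DegreeBelow a (length a)
  DegreeBelow-length []      = mk< λ _ _ → ≋-refl
  DegreeBelow-length (x ∷ a) = mk< λ { (suc n) (s≤s le) → vanishes (DegreeBelow-length a) n le }

  DegreeBelow-cong : ∀ {a b N} → a ≈ b → DegreeBelow b N → DegreeBelow a N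
  DegreeBelow-cong e h = mk< λ n le → ≋-trans (coeff-≋ e n) (vanishes h n le)

  HasDegree-cong : ∀ {a b d} → a ≈ b → HasDegree b d → HasDegree a d
  HasDegree-cong {d = d} e (h , nz) = DegreeBelow-cong e h , λ z → nz (≋-trans (≋-sym (coeff-≋ e d)) z)

  DegreeBelow-mono : ∀ {a M N} → M ≤ N → DegreeBelow a M → DegreeBelow a N
  DegreeBelow-mono le h = mk< λ n le′ → vanishes h n (ℕP.≤-trans le le′)

  DegreeBelow-pred : ∀ {a M} → DegreeBelow a (suc M) → IsZero (coeff a M) → DegreeBelow a M
  DegreeBelow-pred {a} {M} h z = mk< below
    where
    below : ∀ n → M ≤ n → IsZero (coeff a n)
    below n le with ℕP.m≤n⇒m<n∨m≡n le
    ... | inj₁ lt   = vanishes h n lt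
    ... | inj₂ refl = z

  DegreeBelow-zero : ∀ {a} → DegreeBelow a 0 → IsZeroPoly a
  DegreeBelow-zero h = mk≈ λ n → vanishes h n z≤n

  zero⊎degree-below : ∀ N a → DegreeBelow a N → IsZeroPoly a ⊎ ∃ (HasDegree a)
  zero⊎degree-below zero    a h = inj₁ (DegreeBelow-zero h)
  zero⊎degree-below (suc M) a h with isZero? (coeff a M)
  ... | no  nz = inj₂ (M , h , nz)
  ... | yes z  = zero⊎degree-below M a (DegreeBelow-pred h z)

  zero⊎degree : ∀ a → IsZeroPoly a ⊎ ∃ (HasDegree a)
  zero⊎degree a = zero⊎degree-below (length a) a (DegreeBelow-length a)

  HasDegree⇒< : ∀ {a d N} → HasDegree a d → DegreeBelow a N → d < N
  HasDegree⇒< {d = d} (_ , nz) h = ℕP.≰⇒> λ N≤d → nz (vanishes h d N≤d)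

  HasDegree-unique : ∀ {a d e} → HasDegree a d → HasDegree a e → d ≡ e
  HasDegree-unique hd he =
    ℕP.≤-antisym (ℕP.≤-pred (HasDegree⇒< hd (proj₁ he))) (ℕP.≤-pred (HasDegree⇒< he (proj₁ hd)))

  monomial-below : ∀ k c → DegreeBelow (monomial k c) (suc k)
  monomial-below zero    c = DegreeBelow-length (c ∷ [])
  monomial-below (suc k) c = mk< λ { (suc n) (s≤s le) → vanishes (monomial-below k c) n le }

  coeff-monomial : ∀ k c → coeff (monomial k c) k ≡ c
  coeff-monomial zero    c = refl
  coeff-monomial (suc k) c = coeff-monomial k c

  IsZeroPoly⇒¬HasDegree : ∀ {a d} → IsZeroPoly a → ¬ HasDegree a d
  IsZeroPoly⇒¬HasDegree {d = d} z (_ , nz) = nz (coeff-≋ z d)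

  mulP-top : ∀ a b d e → DegreeBelow a (suc d) → DegreeBelow b (suc e) →
             DegreeBelow (mulP a b) (suc (d ℕ.+ e)) × (coeff (mulP a b) (d ℕ.+ e) ≋ coeff a d * coeff b e)
  mulP-top []       b d e ha hb = mk< (λ _ _ → ≋-refl) , ≋-reflexive (sym (ℤP.*-zeroˡ (coeff b e)))
  mulP-top (x ∷ as) b zero e ha hb = below , approx e
    where
    as-zero : IsZeroPoly as
    as-zero = mk≈ λ n → vanishes ha (suc n) (s≤s z≤n)
    approx : ∀ n → coeff (mulP (x ∷ as) b) n ≋ x * coeff b n
    approx n = subst (_≋ x * coeff b n) (sym (coeff-mulP-∷ x as b n))
      (+-IsZeroʳ (x * coeff b n) (coeff-≋ (∷-zero ≋-refl (mulP-zeroˡ {as} b as-zero)) n))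
    below : DegreeBelow (mulP (x ∷ as) b) (suc e)
    below = mk< λ n le → ≋-trans (approx n) (*-IsZeroʳ x (vanishes hb n le))
  mulP-top (x ∷ as) b (suc d) e ha hb = below , top
    where
    ih = mulP-top as b d e (mk< λ n le → vanishes ha (suc n) (s≤s le)) hb
    head-vanishes : ∀ {n} → d ℕ.+ e ≤ n → IsZero (x * coeff b (suc n))
    head-vanishes le = *-IsZeroʳ x (vanishes hb _ (s≤s (ℕP.≤-trans (ℕP.m≤n+m e d) le)))
    below : DegreeBelow (mulP (x ∷ as) b) (suc (suc (d ℕ.+ e)))
    below = mk< λ { (suc n) (s≤s le) → subst IsZero (sym (coeff-mulP-∷ x as b (suc n)))
      (+-≋ (head-vanishes (ℕP.≤-trans (ℕP.n≤1+n _) le)) (vanishes (proj₁ ih) n le)) }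
    top : coeff (mulP (x ∷ as) b) (suc (d ℕ.+ e)) ≋ coeff as d * coeff b e
    top = subst (_≋ coeff as d * coeff b e) (sym (coeff-mulP-∷ x as b (suc (d ℕ.+ e))))
      (≋-trans (+-IsZeroˡ _ (head-vanishes ℕP.≤-refl)) (proj₂ ih))

  stripMod≈ : ∀ a → stripMod q a ≈ a
  stripMod≈ []       = ≈-refl
  stripMod≈ (x ∷ xs) with stripMod q xs | stripMod≈ xs
  ... | y ∷ ys | h = ∷-cong ≋-refl h
  ... | []     | h with q ∣? ∣ x ∣
  ...   | yes d = ≈-sym (∷-zero (∣⇒IsZero d) (≈-sym h))
  ...   | no  _ = ∷-cong ≋-refl h

  stripMod-spec : ∀ a → (stripMod q a ≡ [] × IsZeroPoly a)
                      ⊎ ∃ λ k → length (stripMod q a) ≡ suc k × HasDegree a k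
  stripMod-spec []       = inj₁ (refl , ≈-refl)
  stripMod-spec (x ∷ xs) with stripMod q xs | stripMod-spec xs
  ... | y ∷ ys | inj₁ (() , _)
  ... | y ∷ ys | inj₂ (k , e , (h , nz)) =
    inj₂ (suc k , cong suc e , mk< (λ { (suc n) (s≤s le) → vanishes h n le }) , nz)
  ... | []     | inj₂ (k , () , _)
  ... | []     | inj₁ (_ , z) with q ∣? ∣ x ∣
  ...   | yes d  = inj₁ (refl , ∷-zero (∣⇒IsZero d) z)
  ...   | no  nd = inj₂ (0 , refl , mk< (λ { (suc n) _ → coeff-≋ z n }) , λ zx → nd (IsZero⇒∣ zx))

  degMod-HasDegree : ∀ {a d} → HasDegree a d → degMod q a ≡ d
  degMod-HasDegree {a} hd with stripMod-spec a
  ... | inj₁ (_ , z)       = ⊥-elim (IsZeroPoly⇒¬HasDegree z hd)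
  ... | inj₂ (k , len , hk) = trans (cong (_∸ 1) len) (HasDegree-unique hk hd)

  degMod-zero : ∀ {a} → IsZeroPoly a → degMod q a ≡ 0
  degMod-zero {a} z with stripMod-spec a
  ... | inj₁ (e , _)       = cong (λ l → length l ∸ 1) e
  ... | inj₂ (_ , _ , hk)  = ⊥-elim (IsZeroPoly⇒¬HasDegree z hk)

  subP-top : ∀ {a b M} → DegreeBelow a (suc M) → DegreeBelow b (suc M) →
             coeff a M ≋ coeff b M → DegreeBelow (subP a b) M
  subP-top {a} {b} {M} ha hb top = DegreeBelow-pred below
    (subst IsZero (sym (coeff-subP a b M)) (∣⇒IsZero (∣difference top)))
    where
    below : DegreeBelow (subP a b) (suc M)
    below = mk< λ n le → subst IsZero (sym (coeff-subP a b n)) (+-≋ (vanishes ha n le) (-‿≋ (vanishes hb n le)))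

  HasDegree-degMod : ∀ {a} → ¬ IsZeroPoly a → HasDegree a (degMod q a)
  HasDegree-degMod {a} nz with zero⊎degree a
  ... | inj₁ z        = ⊥-elim (nz z)
  ... | inj₂ (d , hd) = subst (HasDegree a) (sym (degMod-HasDegree hd)) hd

  degMod-cong : ∀ {a b} → a ≈ b → degMod q a ≡ degMod q b
  degMod-cong {a} {b} a≈b with zero⊎degree b
  ... | inj₁ z        = trans (degMod-zero (≈-trans a≈b z)) (sym (degMod-zero z))
  ... | inj₂ (d , hd) = trans (degMod-HasDegree (HasDegree-cong a≈b hd)) (sym (degMod-HasDegree hd))

  DegreeBelow-suc-degMod : ∀ a → DegreeBelow a (suc (degMod q a))
  DegreeBelow-suc-degMod a = DegreeBelow-cong (≈-sym (stripMod≈ a))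
    (DegreeBelow-mono (ℕP.m≤n+m∸n (length (stripMod q a)) 1) (DegreeBelow-length (stripMod q a)))

module DomainDegree (q : ℕ) (q-prime : ∀ m n → q ∣ m ℕ.* n → (q ∣ m) ⊎ (q ∣ n)) where
  open Degree q public

  IsZero-* : ∀ x y → IsZero (x * y) → IsZero x ⊎ IsZero y
  IsZero-* x y z =
    Sum.map ∣⇒IsZero ∣⇒IsZero (q-prime ∣ x ∣ ∣ y ∣ (subst (q ∣_) (ℤP.abs-* x y) (IsZero⇒∣ z)))

  HasDegree-mulP : ∀ {a b d e} → HasDegree a d → HasDegree b e → HasDegree (mulP a b) (d ℕ.+ e)
  HasDegree-mulP {a} {b} {d} {e} (a< , a-top) (b< , b-top) with mulP-top a b d e a< b<
  ... | below , top = below , λ z → [ a-top , b-top ]′ (IsZero-* _ _ (≋-trans (≋-sym top) z))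

  mulP-nonzero : ∀ {a b} → ¬ IsZeroPoly a → ¬ IsZeroPoly b → ¬ IsZeroPoly (mulP a b)
  mulP-nonzero {a} {b} na nb z =
    IsZeroPoly⇒¬HasDegree z (HasDegree-mulP (HasDegree-degMod {a} na) (HasDegree-degMod {b} nb))

  degMod-mulP : ∀ a b → ¬ IsZeroPoly (mulP a b) → degMod q (mulP a b) ≡ degMod q a ℕ.+ degMod q b
  degMod-mulP a b nz = degMod-HasDegree
    (HasDegree-mulP (HasDegree-degMod {a} (nz ∘ mulP-zeroˡ b)) (HasDegree-degMod {b} (nz ∘ mulP-zeroʳ a)))

  mulP-cancelˡ : ∀ {g x y} → ¬ IsZeroPoly g → mulP g x ≈ mulP g y → x ≈ y
  mulP-cancelˡ {g} {x} {y} nz gx≈gy with zero⊎degree (subP x y)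
  ... | inj₁ z = begin
    x                ≈⟨ solve 2 (λ x y → x := (x :- y) :+ y) ≈-refl x y ⟩
    addP (subP x y) y ≈⟨ addP-cong z ≈-refl ⟩
    y                ∎
    where open import Relation.Binary.Reasoning.Setoid ≈-setoid
  ... | inj₂ (_ , hd) = ⊥-elim (mulP-nonzero nz (λ z → IsZeroPoly⇒¬HasDegree z hd) (begin
    mulP g (subP x y)                   ≈⟨ solve 3 (λ g x y → g :* (x :- y) := g :* x :- g :* y) ≈-refl g x y ⟩
    subP (mulP g x) (mulP g y)          ≈⟨ addP-cong gx≈gy ≈-refl ⟩
    subP (mulP g y) (mulP g y)          ≈⟨ addP-inverseʳ (mulP g y) ⟩
    []                                  ∎))
    where open import Relation.Binary.Reasoning.Setoid ≈-setoid

module PrimeField (p : ℕ) (prime : Prime p) where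
  open DomainDegree p (λ m n → euclidsLemma m n prime) public
  open import Relation.Binary.Reasoning.Setoid ≈-setoid

  ¬IsZero-1 : ¬ IsZero (+ 1)
  ¬IsZero-1 z = ¬prime[1] (subst Prime (ℕ∣.∣1⇒≡1 (IsZero⇒∣ z)) prime)

  private
    coprime-to-p : ∀ {m} → ¬ p ∣ m → Coprime m p
    coprime-to-p p∤m (d∣m , d∣p) with prime⇒irreducible prime d∣p
    ... | inj₁ d≡1 = d≡1
    ... | inj₂ refl = ⊥-elim (p∤m d∣m)

    multiple-IsZero : ∀ k → IsZero (+ (k ℕ.* p))
    multiple-IsZero k = ∣⇒IsZero (ℕ∣.n∣m*n k)

    inverse-ℕ : ∀ {m} → ¬ p ∣ m → ∃ λ u → u * + m ≋ + 1
    inverse-ℕ {m} p∤m with coprime-Bézout (coprime-to-p p∤m)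
    ... | Bézout.+- x y 1+yp≡xm = + x , ≋-trans (≋-reflexive xm≡1+yp) (+-IsZeroʳ (+ 1) (multiple-IsZero y))
      where
      xm≡1+yp : + x * + m ≡ + 1 + + (y ℕ.* p)
      xm≡1+yp = trans (sym (ℤP.pos-* x m)) (trans (cong +_ (sym 1+yp≡xm)) (ℤP.pos-+ 1 (y ℕ.* p)))
    ... | Bézout.-+ x y 1+xm≡yp =
      - + x , ≋-trans (≋-reflexive (identity (+ x) (+ m))) (+-IsZeroʳ (+ 1) (-‿≋ 1+xm≋0))
      where
      identity : ∀ X M → (- X) * M ≡ + 1 + - (+ 1 + X * M)
      identity = solve-∀
      1+xm≋0 : IsZero (+ 1 + + x * + m)
      1+xm≋0 = subst IsZero (trans (cong +_ (sym 1+xm≡yp))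
                                   (trans (ℤP.pos-+ 1 (x ℕ.* m)) (cong (_+_ (+ 1)) (ℤP.pos-* x m))))
                            (multiple-IsZero y)

  inverse : ∀ {c} → ¬ IsZero c → ∃ λ u → u * c ≋ + 1
  inverse {+ m}      nz = inverse-ℕ (nz ∘ ∣⇒IsZero)
  inverse { -[1+ n ]} nz with inverse-ℕ {suc n} (nz ∘ ∣⇒IsZero)
  ... | u , u*m≋1 = - u , subst (_≋ + 1) (sym (identity u (+ suc n))) u*m≋1
    where
    identity : ∀ u m → (- u) * (- m) ≡ u * m
    identity = solve-∀

  infix 4 _∣ₘ_
  _∣ₘ_ : Poly → Poly → Set
  a ∣ₘ b = ∃ λ k → mulP a k ≈ b

  ∣ₘ-respʳ : ∀ {a b c} → b ≈ c → a ∣ₘ b → a ∣ₘ c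
  ∣ₘ-respʳ b≈c (k , ak≈b) = k , ≈-trans ak≈b b≈c

  ∣ₘ-trans : ∀ {a b c} → a ∣ₘ b → b ∣ₘ c → a ∣ₘ c
  ∣ₘ-trans {a} (k , ak≈b) (l , bl≈c) =
    mulP k l , ≈-trans (≈-sym (mulP-assoc a k l)) (≈-trans (mulP-congˡ l ak≈b) bl≈c)

  ∣ₘ-refl : ∀ {a} → a ∣ₘ a
  ∣ₘ-refl {a} = oneP , ≈-trans (mulP-comm a oneP) (mulP-identityˡ a)

  ∣ₘ-zero : ∀ {a b} → IsZeroPoly b → a ∣ₘ b
  ∣ₘ-zero {a} z = [] , ≈-trans (mulP-[] a) (≈-sym z)

  ∣ₘ-linear : ∀ {d a b} s t → d ∣ₘ a → d ∣ₘ b → d ∣ₘ addP (mulP s a) (mulP t b)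
  ∣ₘ-linear {d} {a} {b} s t (k , dk≈a) (l , dl≈b) = addP (mulP s k) (mulP t l) , (begin
    mulP d (addP (mulP s k) (mulP t l))
      ≈⟨ solve 5 (λ d s k t l → d :* (s :* k :+ t :* l) := s :* (d :* k) :+ t :* (d :* l)) ≈-refl d s k t l ⟩
    addP (mulP s (mulP d k)) (mulP t (mulP d l))
      ≈⟨ addP-cong (mulP-congʳ s dk≈a) (mulP-congʳ t dl≈b) ⟩
    addP (mulP s a) (mulP t b) ∎)

  constant-unit : ∀ {k} → HasDegree k 0 → k ∣ₘ oneP
  constant-unit {k} (k< , nz) with inverse nz
  ... | u , uc≋1 = u ∷ [] , ≈-trans (mulP-comm k (u ∷ [])) (mk≈ λ
    { zero    → subst (_≋ + 1) (sym (coeff-mulP-∷ u [] k 0)) (≋-trans (+-IsZeroʳ _ ≋-refl) uc≋1)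
    ; (suc n) → subst IsZero (sym (coeff-mulP-∷ u [] k (suc n)))
                  (≋-trans (+-IsZeroʳ _ ≋-refl) (*-IsZeroʳ u (vanishes k< (suc n) (s≤s z≤n)))) })

  module _ {h e} (h-degree : HasDegree h e) (lc-inverse : ∃ λ u → u * coeff h e ≋ + 1) where
    private
      u = proj₁ lc-inverse

      cancel-top : ∀ {g M} → e ≤ M → DegreeBelow g (suc M) → ∃ λ t → DegreeBelow (subP g (mulP t h)) M
      cancel-top {g} {M} e≤M g< = t , subP-top g< th< (≋-sym th-top)
        where
        j = M ∸ e
        t = monomial j (coeff g M * u)
        j+e≡M : j ℕ.+ e ≡ M
        j+e≡M = ℕP.m∸n+n≡m e≤M
        th = mulP-top t h j e (monomial-below j _) (proj₁ h-degree)
        th< : DegreeBelow (mulP t h) (suc M)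
        th< = subst (λ n → DegreeBelow (mulP t h) (suc n)) j+e≡M (proj₁ th)
        th-top : coeff (mulP t h) M ≋ coeff g M
        th-top = subst (λ n → coeff (mulP t h) n ≋ coeff g M) j+e≡M (≋-trans (proj₂ th)
          (subst (λ x → x * coeff h e ≋ coeff g M) (sym (coeff-monomial j _))
                 (*-inverse-cancelʳ (coeff g M) (proj₂ lc-inverse))))

    divMod : ∀ N g → DegreeBelow g N → ∃₂ λ Q r → g ≈ addP (mulP Q h) r × DegreeBelow r e
    divMod zero    g g< = [] , g , ≈-refl , DegreeBelow-mono z≤n g<
    divMod (suc M) g g< with suc M ≤? e
    ... | yes M<e = [] , g , ≈-refl , DegreeBelow-mono M<e g<
    ... | no  M≮e = divide-rest (cancel-top (ℕP.≤-pred (ℕP.≰⇒> M≮e)) g<)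
      where
      divide-rest : (∃ λ t → DegreeBelow (subP g (mulP t h)) M) →
                    ∃₂ λ Q r → g ≈ addP (mulP Q h) r × DegreeBelow r e
      divide-rest (t , g′<) with divMod M (subP g (mulP t h)) g′<
      ... | Q , r , g′≈Qh+r , r< = addP Q t , r , (begin
        g
          ≈⟨ solve 2 (λ g x → g := (g :- x) :+ x) ≈-refl g (mulP t h) ⟩
        addP (subP g (mulP t h)) (mulP t h)
          ≈⟨ addP-cong g′≈Qh+r ≈-refl ⟩
        addP (addP (mulP Q h) r) (mulP t h)
          ≈⟨ solve 4 (λ Q h r t → (Q :* h :+ r) :+ t :* h := (Q :+ t) :* h :+ r) ≈-refl Q h r t ⟩
        addP (mulP (addP Q t) h) r ∎) , r<

  bezout : ∀ N g a → DegreeBelow a N →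
           ∃ λ d → (∃₂ λ s t → addP (mulP s g) (mulP t a) ≈ d) × d ∣ₘ g × d ∣ₘ a
  bezout zero    g a a< = g , (oneP , [] , ≈-trans (addP-identityʳ _) (mulP-identityˡ g)) , ∣ₘ-refl {g} ,
                          ∣ₘ-zero {g} (DegreeBelow-zero a<)
  bezout (suc M) g a a< with isZero? (coeff a M)
  ... | yes z  = bezout M g a (DegreeBelow-pred a< z)
  ... | no  nz = bezout-step (divMod (a< , nz) (inverse nz) (length g) g (DegreeBelow-length g))
    where
    bezout-step : (∃₂ λ Q r → g ≈ addP (mulP Q a) r × DegreeBelow r M) →
                  ∃ λ d → (∃₂ λ s t → addP (mulP s g) (mulP t a) ≈ d) × d ∣ₘ g × d ∣ₘ a
    bezout-step (Q , r , g≈Qa+r , r<) with bezout M a r r<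
    ... | d , (s , t , sa+tr≈d) , d∣a , d∣r = d , (t , subP s (mulP t Q) , combination) , d∣g , d∣a
      where
      d∣g : d ∣ₘ g
      d∣g = ∣ₘ-respʳ {d} (≈-trans (addP-cong ≈-refl (mulP-identityˡ r)) (≈-sym g≈Qa+r))
                         (∣ₘ-linear {d} Q oneP d∣a d∣r)
      combination : addP (mulP t g) (mulP (subP s (mulP t Q)) a) ≈ d
      combination = begin
        addP (mulP t g) (mulP (subP s (mulP t Q)) a)
          ≈⟨ addP-cong (mulP-congʳ t g≈Qa+r) ≈-refl ⟩
        addP (mulP t (addP (mulP Q a) r)) (mulP (subP s (mulP t Q)) a)
          ≈⟨ solve 5 (λ t Q a r s → t :* (Q :* a :+ r) :+ (s :- t :* Q) :* a := s :* a :+ t :* r)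
                     ≈-refl t Q a r s ⟩
        addP (mulP s a) (mulP t r)
          ≈⟨ sa+tr≈d ⟩
        d ∎

  irreducible-nonzero : ∀ {g} → IrredMod p g → ¬ IsZeroPoly g
  irreducible-nonzero (1≤deg , _) z with () ← subst (1 ≤_) (degMod-zero z) 1≤deg

  degMod≡0⇒unit : ∀ {k} → ¬ IsZeroPoly k → degMod p k ≡ 0 → k ∣ₘ oneP
  degMod≡0⇒unit {k} nz deg≡0 = constant-unit (subst (HasDegree k) deg≡0 (HasDegree-degMod nz))

  irreducible-∣⊎coprime : ∀ {g} → IrredMod p g → ∀ a →
                          g ∣ₘ a ⊎ ∃₂ λ s t → addP (mulP s g) (mulP t a) ≈ oneP
  irreducible-∣⊎coprime {g} irr a = from-gcd (bezout (length a) g a (DegreeBelow-length a))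
    where
    from-gcd : (∃ λ d → (∃₂ λ s t → addP (mulP s g) (mulP t a) ≈ d) × d ∣ₘ g × d ∣ₘ a) →
               g ∣ₘ a ⊎ ∃₂ λ s t → addP (mulP s g) (mulP t a) ≈ oneP
    from-gcd (d , (s , t , sg+ta≈d) , (k , dk≈g) , d∣a) =
      [ inj₂ ∘ gcd-unit , inj₁ ∘ cofactor-unit ]′ (proj₂ irr d k (≈⇒EqMod (≈-sym dk≈g)))
      where
      gcd-unit : degMod p d ≡ 0 → ∃₂ λ s t → addP (mulP s g) (mulP t a) ≈ oneP
      gcd-unit deg-d≡0 = mulP d′ s , mulP d′ t , (begin
        addP (mulP (mulP d′ s) g) (mulP (mulP d′ t) a)
          ≈⟨ solve 5 (λ d′ s g t a → (d′ :* s) :* g :+ (d′ :* t) :* a := (s :* g :+ t :* a) :* d′)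
                     ≈-refl d′ s g t a ⟩
        mulP (addP (mulP s g) (mulP t a)) d′
          ≈⟨ mulP-congˡ d′ sg+ta≈d ⟩
        mulP d d′
          ≈⟨ dd′≈1 ⟩
        oneP ∎)
        where
        d-nonzero : ¬ IsZeroPoly d
        d-nonzero z = irreducible-nonzero irr (≈-trans (≈-sym dk≈g) (mulP-zeroˡ k z))
        d′ = proj₁ (degMod≡0⇒unit d-nonzero deg-d≡0)
        dd′≈1 = proj₂ (degMod≡0⇒unit d-nonzero deg-d≡0)
      cofactor-unit : degMod p k ≡ 0 → g ∣ₘ a
      cofactor-unit deg-k≡0 = ∣ₘ-trans {g} (k′ , (begin
        mulP g k′          ≈⟨ mulP-congˡ k′ (≈-sym dk≈g) ⟩
        mulP (mulP d k) k′ ≈⟨ mulP-assoc d k k′ ⟩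
        mulP d (mulP k k′) ≈⟨ mulP-congʳ d kk′≈1 ⟩
        mulP d oneP        ≈⟨ proj₂ (∣ₘ-refl {d}) ⟩
        d                  ∎)) d∣a
        where
        k-nonzero : ¬ IsZeroPoly k
        k-nonzero z = irreducible-nonzero irr (≈-trans (≈-sym dk≈g) (mulP-zeroʳ d z))
        k′ = proj₁ (degMod≡0⇒unit k-nonzero deg-k≡0)
        kk′≈1 = proj₂ (degMod≡0⇒unit k-nonzero deg-k≡0)

  irreducible-prime : ∀ {g a b} → IrredMod p g → g ∣ₘ mulP a b → g ∣ₘ a ⊎ g ∣ₘ b
  irreducible-prime {g} {a} {b} irr (c , gc≈ab) = Sum.map₂ coprime⇒∣b (irreducible-∣⊎coprime irr a)
    where
    coprime⇒∣b : (∃₂ λ s t → addP (mulP s g) (mulP t a) ≈ oneP) → g ∣ₘ b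
    coprime⇒∣b (s , t , sg+ta≈1) = addP (mulP s b) (mulP t c) , (begin
      mulP g (addP (mulP s b) (mulP t c))
        ≈⟨ solve 5 (λ g s b t c → g :* (s :* b :+ t :* c) := (s :* g) :* b :+ t :* (g :* c)) ≈-refl g s b t c ⟩
      addP (mulP (mulP s g) b) (mulP t (mulP g c))
        ≈⟨ addP-cong ≈-refl (mulP-congʳ t gc≈ab) ⟩
      addP (mulP (mulP s g) b) (mulP t (mulP a b))
        ≈⟨ solve 5 (λ s g b t a → (s :* g) :* b :+ t :* (a :* b) := (s :* g :+ t :* a) :* b) ≈-refl s g b t a ⟩
      mulP (addP (mulP s g) (mulP t a)) b
        ≈⟨ mulP-congˡ b sg+ta≈1 ⟩
      mulP oneP b
        ≈⟨ mulP-identityˡ b ⟩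
      b ∎)

  degMod-oneP : degMod p oneP ≡ 0
  degMod-oneP = degMod-HasDegree (DegreeBelow-length oneP , ¬IsZero-1)

  prodP-nonzero : ∀ {gs} → All (IrredMod p) gs → ¬ IsZeroPoly (prodP gs)
  prodP-nonzero []                    z = ¬IsZero-1 (coeff-≋ z 0)
  prodP-nonzero {g ∷ gs} (irr ∷ irrs) = mulP-nonzero {g} (irreducible-nonzero irr) (prodP-nonzero irrs)

  factor-degree∈subsetSums : ∀ gs → All (IrredMod p) gs → ∀ a b → mulP a b ≈ prodP gs →
                             SubsetSum (map (degMod p) gs) (degMod p a)
  factor-degree∈subsetSums [] [] a b ab≈1 = subst (SubsetSum []) (sym deg-a≡0) ss-nil
    where
    deg-a≡0 : degMod p a ≡ 0
    deg-a≡0 = ℕP.m+n≡0⇒m≡0 (degMod p a)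
      (trans (sym (degMod-mulP a b ab-nonzero)) (trans (degMod-cong ab≈1) degMod-oneP))
      where
      ab-nonzero : ¬ IsZeroPoly (mulP a b)
      ab-nonzero = prodP-nonzero [] ∘ ≈-trans (≈-sym ab≈1)
  factor-degree∈subsetSums (g ∷ gs) (irr ∷ irrs) a b ab≈ggs =
    [ g∣a , g∣b ]′ (irreducible-prime {g} irr (prodP gs , ≈-sym ab≈ggs))
    where
    g-nonzero : ¬ IsZeroPoly g
    g-nonzero = irreducible-nonzero irr
    g∣b : g ∣ₘ b → SubsetSum (map (degMod p) (g ∷ gs)) (degMod p a)
    g∣b (b′ , gb′≈b) = ss-skip (factor-degree∈subsetSums gs irrs a b′ (mulP-cancelˡ g-nonzero (begin
      mulP g (mulP a b′) ≈⟨ solve 3 (λ g a b′ → g :* (a :* b′) := a :* (g :* b′)) ≈-refl g a b′ ⟩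
      mulP a (mulP g b′) ≈⟨ mulP-congʳ a gb′≈b ⟩
      mulP a b           ≈⟨ ab≈ggs ⟩
      mulP g (prodP gs)  ∎)))
    g∣a : g ∣ₘ a → SubsetSum (map (degMod p) (g ∷ gs)) (degMod p a)
    g∣a (a′ , ga′≈a) =
      subst (SubsetSum _) (sym deg-a) (ss-take (factor-degree∈subsetSums gs irrs a′ b a′b≈gs))
      where
      a′b≈gs : mulP a′ b ≈ prodP gs
      a′b≈gs = mulP-cancelˡ g-nonzero (begin
        mulP g (mulP a′ b) ≈⟨ ≈-sym (mulP-assoc g a′ b) ⟩
        mulP (mulP g a′) b ≈⟨ mulP-congˡ b ga′≈a ⟩
        mulP a b           ≈⟨ ab≈ggs ⟩
        mulP g (prodP gs)  ∎)
      a′-nonzero : ¬ IsZeroPoly a′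
      a′-nonzero z = prodP-nonzero irrs (≈-trans (≈-sym a′b≈gs) (mulP-zeroˡ b z))
      deg-a : degMod p a ≡ degMod p g ℕ.+ degMod p a′
      deg-a = trans (sym (degMod-cong ga′≈a)) (degMod-mulP g a′ (mulP-nonzero g-nonzero a′-nonzero))

-- Modulo 0 the congruence ≋ is equality, so this instance is the degree theory of ℤ[X] itself.
module ℤ[X] = DomainDegree 0 (λ m n 0∣mn →
  Sum.map (λ m≡0 → subst (0 ∣_) (sym m≡0) (0 ∣0)) (λ n≡0 → subst (0 ∣_) (sym n≡0) (0 ∣0))
          (ℕP.m*n≡0⇒m≡0∨n≡0 m (ℕ∣.0∣⇒≡0 0∣mn)))

≋₀⇒≡ : ∀ {x y} → x ℤ[X].≋ y → x ≡ y
≋₀⇒≡ {x} {y} x≋y = ℤP.i-j≡0⇒i≡j x y (ℤP.∣i∣≡0⇒i≡0 (ℕ∣.0∣⇒≡0 (ℤ[X].∣difference x≋y)))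

strip≡stripMod0 : ∀ a → strip a ≡ stripMod 0 a
strip≡stripMod0 []       = refl
strip≡stripMod0 (x ∷ xs) with strip xs | stripMod 0 xs | strip≡stripMod0 xs
... | y ∷ ys | .(y ∷ ys) | refl = refl
... | []     | .[]       | refl with ∣ x ∣ ℕ.≟ 0 | 0 ∣? ∣ x ∣
...   | yes _     | yes _    = refl
...   | no  _     | no  _    = refl
...   | yes ∣x∣≡0 | no  0∤x  = ⊥-elim (0∤x (subst (0 ∣_) (sym ∣x∣≡0) (0 ∣0)))
...   | no  ∣x∣≢0 | yes 0∣x  = ⊥-elim (∣x∣≢0 (ℕ∣.0∣⇒≡0 0∣x))

deg≡degMod0 : ∀ a → deg a ≡ degMod 0 a
deg≡degMod0 a = cong (λ l → length l ∸ 1) (strip≡stripMod0 a)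

lastOr-coeff : ∀ y ys → lastOr y ys ≡ coeff (y ∷ ys) (length ys)
lastOr-coeff y []       = refl
lastOr-coeff y (z ∷ zs) = lastOr-coeff z zs

lastOr0-coeff : ∀ xs → lastOr (+ 0) xs ≡ coeff xs (length xs ∸ 1)
lastOr0-coeff []       = refl
lastOr0-coeff (y ∷ ys) = lastOr-coeff y ys

lc≡coeff-deg : ∀ a → lc a ≡ coeff a (deg a)
lc≡coeff-deg a = begin
  lastOr (+ 0) (strip a)        ≡⟨ cong (lastOr (+ 0)) (strip≡stripMod0 a) ⟩
  lastOr (+ 0) (stripMod 0 a)   ≡⟨ lastOr0-coeff (stripMod 0 a) ⟩
  coeff (stripMod 0 a) (degMod 0 a) ≡⟨ ≋₀⇒≡ (ℤ[X].coeff-≋ (ℤ[X].stripMod≈ a) (degMod 0 a)) ⟩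
  coeff a (degMod 0 a)          ≡⟨ cong (coeff a) (sym (deg≡degMod0 a)) ⟩
  coeff a (deg a)               ∎
  where open ≡-Reasoning

m≤n∧o≤p∧m+o≡n+p⇒m≡n : ∀ {m n o p} → m ≤ n → o ≤ p → m ℕ.+ o ≡ n ℕ.+ p → m ≡ n
m≤n∧o≤p∧m+o≡n+p⇒m≡n {m} {n} {o} {p} m≤n o≤p eq = ℕP.≤-antisym m≤n
  (ℕP.+-cancelʳ-≤ o n m (subst (n ℕ.+ o ≤_) (sym eq) (ℕP.+-monoʳ-≤ n o≤p)))

ℤ[X]-DegreeBelow-suc-deg : ∀ a → ℤ[X].DegreeBelow a (suc (deg a))
ℤ[X]-DegreeBelow-suc-deg a =
  subst (λ d → ℤ[X].DegreeBelow a (suc d)) (sym (deg≡degMod0 a)) (ℤ[X].DegreeBelow-suc-degMod a)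

module _ {p : ℕ} (prime : Prime p) where
  private module 𝔽ₚ[X] = PrimeField p prime

  reduce : ∀ {a b} → a ℤ[X].≈ b → a 𝔽ₚ[X].≈ b
  reduce a≈b = 𝔽ₚ[X].mk≈ λ n → 𝔽ₚ[X].≋-reflexive (≋₀⇒≡ (ℤ[X].coeff-≋ a≈b n))

  DegreeBelow-suc-deg : ∀ a → 𝔽ₚ[X].DegreeBelow a (suc (deg a))
  DegreeBelow-suc-deg a =
    𝔽ₚ[X].mk< λ n le → 𝔽ₚ[X].≋-reflexive (≋₀⇒≡ (ℤ[X].vanishes (ℤ[X]-DegreeBelow-suc-deg a) n le))

  degMod≤deg : ∀ a → degMod p a ≤ deg a
  degMod≤deg a with 𝔽ₚ[X].zero⊎degree a
  ... | inj₁ z        = subst (_≤ deg a) (sym (𝔽ₚ[X].degMod-zero z)) z≤n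
  ... | inj₂ (d , hd) = subst (_≤ deg a) (sym (𝔽ₚ[X].degMod-HasDegree hd))
                              (ℕP.≤-pred (𝔽ₚ[X].HasDegree⇒< hd (DegreeBelow-suc-deg a)))

  HasDegree-deg : ∀ {f} → ¬ p ∣ ∣ lc f ∣ → 𝔽ₚ[X].HasDegree f (deg f)
  HasDegree-deg {f} p∤lc = DegreeBelow-suc-deg f ,
    λ z → p∤lc (subst (λ t → p ∣ ∣ t ∣) (sym (lc≡coeff-deg f)) (𝔽ₚ[X].IsZero⇒∣ z))

  degMod≡deg : ∀ {f a b} → ¬ p ∣ ∣ lc f ∣ → mulP a b ≈ₚ f → degMod p a ≡ deg a
  degMod≡deg {f} {a} {b} p∤lc ab≈f =
    m≤n∧o≤p∧m+o≡n+p⇒m≡n (degMod≤deg a) (degMod≤deg b) (begin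
      degMod p a ℕ.+ degMod p b ≡⟨ sym (𝔽ₚ[X].degMod-mulP a b ab-nonzero) ⟩
      degMod p (mulP a b)       ≡⟨ 𝔽ₚ[X].degMod-cong (𝔽ₚ[X].≈ₚ⇒≈ {mulP a b} {f} ab≈f) ⟩
      degMod p f                ≡⟨ 𝔽ₚ[X].degMod-HasDegree f-degree ⟩
      deg f                     ≡⟨ deg≡degMod0 f ⟩
      degMod 0 f                ≡⟨ sym (ℤ[X].degMod-cong (ℤ[X].≈ₚ⇒≈ {mulP a b} {f} ab≈f)) ⟩
      degMod 0 (mulP a b)       ≡⟨ ℤ[X].degMod-mulP a b (ab-nonzero ∘ reduce) ⟩
      degMod 0 a ℕ.+ degMod 0 b ≡⟨ sym (cong₂ ℕ._+_ (deg≡degMod0 a) (deg≡degMod0 b)) ⟩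
      deg a ℕ.+ deg b           ∎)
    where
    open ≡-Reasoning
    f-degree : 𝔽ₚ[X].HasDegree f (deg f)
    f-degree = HasDegree-deg p∤lc
    ab-nonzero : ¬ 𝔽ₚ[X].IsZeroPoly (mulP a b)
    ab-nonzero z = 𝔽ₚ[X].IsZeroPoly⇒¬HasDegree
      (𝔽ₚ[X].≈-trans (𝔽ₚ[X].≈-sym (𝔽ₚ[X].≈ₚ⇒≈ {mulP a b} {f} ab≈f)) z) f-degree

  deg-factor∈subsetSums : ∀ {f a b gs} → ¬ p ∣ ∣ lc f ∣ → mulP a b ≈ₚ f →
                          All (IrredMod p) gs → EqMod p f (prodP gs) → SubsetSum (map (degMod p) gs) (deg a)
  deg-factor∈subsetSums {f} {a} {b} {gs} p∤lc ab≈f irreducible f≡∏gs =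
    subst (SubsetSum (map (degMod p) gs)) (degMod≡deg {f} {a} {b} p∤lc ab≈f)
      (𝔽ₚ[X].factor-degree∈subsetSums gs irreducible a b
        (𝔽ₚ[X].≈-trans (𝔽ₚ[X].≈ₚ⇒≈ {mulP a b} {f} ab≈f) (𝔽ₚ[X].EqMod⇒≈ {f} f≡∏gs)))

content-greatest : ∀ {k} f → (∀ n → k ∣ ∣ coeff f n ∣) → k ∣ content f
content-greatest []      _     = _ ∣0
content-greatest (x ∷ f) k∣f·  = gcd-greatest (k∣f· 0) (content-greatest f (k∣f· ∘ suc))

∣c∣≡1⇒c≡±1 : ∀ {c} → ∣ c ∣ ≡ 1 → c ≡ + 1 ⊎ c ≡ -[1+ 0 ]
∣c∣≡1⇒c≡±1 {+ suc zero}   _ = inj₁ refl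
∣c∣≡1⇒c≡±1 { -[1+ zero ]} _ = inj₂ refl
∣c∣≡1⇒c≡±1 {+ zero}       ()
∣c∣≡1⇒c≡±1 {+ suc (suc n)} ()
∣c∣≡1⇒c≡±1 { -[1+ suc n ]} ()

constant-factor-of-primitive : ∀ {f c b} → Primitive f → mulP (c ∷ []) b ≈ₚ f → ∣ c ∣ ≡ 1
constant-factor-of-primitive {f} {c} {b} prim cb≈f =
  ℕ∣.∣1⇒≡1 (subst (∣ c ∣ ∣_) prim (content-greatest f c∣f·))
  where
  c∣f· : ∀ n → ∣ c ∣ ∣ ∣ coeff f n ∣
  c∣f· n = subst (λ t → ∣ c ∣ ∣ ∣ t ∣) (trans (sym (coeff-constant-mulP n)) (cb≈f n))
             (subst (∣ c ∣ ∣_) (sym (ℤP.abs-* c (coeff b n))) (ℕ∣.m∣m*n ∣ coeff b n ∣))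
    where
    coeff-constant-mulP : ∀ n → coeff (mulP (c ∷ []) b) n ≡ c * coeff b n
    coeff-constant-mulP zero    = trans (coeff-mulP-∷ c [] b 0) (ℤP.+-identityʳ _)
    coeff-constant-mulP (suc n) = trans (coeff-mulP-∷ c [] b (suc n)) (ℤP.+-identityʳ _)

divisor-of-primitive-deg≢0 : ∀ {f a} → Primitive f → a ∣ₚ f →
                             ¬ (a ≈ₚ (+ 1 ∷ [])) → ¬ (a ≈ₚ (-[1+ 0 ] ∷ [])) → deg a ≢ 0
divisor-of-primitive-deg≢0 {f} {a} prim (b , ab≈f) a≉1 a≉-1 deg≡0 =
  [ a≉1 ∘ a≈ , a≉-1 ∘ a≈ ]′ (∣c∣≡1⇒c≡±1 (constant-factor-of-primitive {f} {c} {b} prim cb≈f))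
  where
  c = coeff a 0
  a≈c : a ≈ₚ (c ∷ [])
  a≈c zero    = refl
  a≈c (suc n) = ≋₀⇒≡ (ℤ[X].vanishes below (suc n) (s≤s z≤n))
    where
    below : ℤ[X].DegreeBelow a 1
    below = subst (λ d → ℤ[X].DegreeBelow a (suc d)) deg≡0 (ℤ[X]-DegreeBelow-suc-deg a)
  a≈ : ∀ {u} → c ≡ u → a ≈ₚ (u ∷ [])
  a≈ refl = a≈c
  cb≈f : mulP (c ∷ []) b ≈ₚ f
  cb≈f n = trans (sym (≋₀⇒≡ (ℤ[X].coeff-≋ (ℤ[X].mulP-congˡ b (ℤ[X].≈ₚ⇒≈ {a} {c ∷ []} a≈c)) n)))
                 (ab≈f n)

subsetSum? : ∀ ds n → Dec (SubsetSum ds n)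
subsetSum? []       zero    = yes ss-nil
subsetSum? []       (suc n) = no λ ()
subsetSum? (d ∷ ds) n with subsetSum? ds n | d ≤? n
... | yes s | _      = yes (ss-skip s)
... | no ¬s | no d≰n = no λ { (ss-skip s) → ¬s s ; (ss-take {n = m} _) → d≰n (ℕP.m≤m+n d m) }
... | no ¬s | yes d≤n with subsetSum? ds (n ∸ d)
...   | yes s  = yes (subst (SubsetSum (d ∷ ds)) (ℕP.m+[n∸m]≡n d≤n) (ss-take s))
...   | no ¬s′ = no λ { (ss-skip s) → ¬s s
                      ; (ss-take {n = m} s) → ¬s′ (subst (SubsetSum ds) (sym (ℕP.m+n∸m≡n d m)) s) }

module _ {P : ℕ → Set} (P? : ∀ n → Dec (P n)) where

  Least : ℕ → Set
  Least n = ∃ λ d → (P d × (∀ e → P e → d ≤ e)) × d ≤ n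

  least : ∀ n → P n → Least n
  least = <-rec (λ n → P n → Least n) step
    where
    step : ∀ n → (∀ {m} → m < n → P m → Least m) → P n → Least n
    step n rec pn with ℕP.anyUpTo? P? n
    ... | no  none = n , (pn , λ e pe → ℕP.≮⇒≥ λ e<n → none (e , e<n , pe)) , ℕP.≤-refl
    ... | yes (m , m<n , pm) =
      let d , minimal , d≤m = rec m<n pm in d , minimal , ℕP.≤-trans d≤m (ℕP.<⇒≤ m<n)

proposition3p3 : (f : Poly) → Primitive f →
    (m : ℕ) → 1 ≤ m →
    (ps : Fin m → ℕ) → Injective _≡_ _≡_ ps →
    (∀ i → Prime (ps i)) →
    (∀ i → ¬ (ps i ∣ ∣ lc f ∣)) →
    (facs : Fin m → List Poly) →
    (∀ i → All (IrredMod (ps i)) (facs i)) →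
    (∀ i → EqMod (ps i) f (prodP (facs i))) →
    (a : Poly) → a ∣ₚ f →
    ¬ (a ≈ₚ (+ 1 ∷ [])) → ¬ (a ≈ₚ (-[1+ 0 ] ∷ [])) →
    Σ ℕ (λ d →
      ((d ≢ 0 × (∀ i → SubsetSum (map (degMod (ps i)) (facs i)) d))
       × (∀ e → e ≢ 0 → (∀ i → SubsetSum (map (degMod (ps i)) (facs i)) e) → d ≤ e))
      × d ≤ deg a)
proposition3p3 f prim m _ ps _ prime p∤lc facs irreducible factorisation a (b , ab≈f) a≉1 a≉-1 =
  let d , ((d≢0 , d∈S) , minimal) , d≤deg-a = least common? (deg a) (deg-a≢0 , deg-a∈S)
  in  d , ((d≢0 , d∈S) , λ e e≢0 e∈S → minimal e (e≢0 , e∈S)) , d≤deg-a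
  where
  S : Fin m → ℕ → Set
  S i = SubsetSum (map (degMod (ps i)) (facs i))
  common? : ∀ e → Dec (e ≢ 0 × ∀ i → S i e)
  common? e = ¬? (e ℕ.≟ 0) ×-dec FinP.all? (λ i → subsetSum? _ e)
  deg-a≢0 : deg a ≢ 0
  deg-a≢0 = divisor-of-primitive-deg≢0 {f} {a} prim (b , ab≈f) a≉1 a≉-1
  deg-a∈S : ∀ i → S i (deg a)
  deg-a∈S i = deg-factor∈subsetSums (prime i) {f} {a} {b} (p∤lc i) ab≈f (irreducible i) (factorisation i)
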